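{- Let $m\ge 6$ and let $G$ be either the Kneser graph $K(m,2)$ or the Johnson graph $J(m,2)$. Then $$\frac{2m}{3}\le\gamma^{\rm ID}(G)\le\frac{4(m+1)}{3}.$$ In particular $\gamma^{\rm ID}(G)=\Theta(\sqrt{|V|})$.
   Context: The Johnson graph $J(m,2)$ has as vertices the $2$-element subsets of an $m$-element set, two being adjacent if they share exactly one element. The Kneser graph $K(m,2)$ has the same vertex set, two subsets being adjacent if they are disjoint. An identifying code of a graph is a set $C$ of vertices with $N[u]\cap C\neq\emptyset$ for all vertices $u$ and $N[u]\cap C\neq N[v]\cap C$ for all distinct $u,v$, where $N[u]$ is the closed neighbourhood; $\gamma^{\rm ID}(G)$ is the minimum size of an identifying code. -}

module Defs where

open import Data.Nat using (ℕ)
open import Data.Fin using (Fin; _<_)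
open import Data.Product using (Σ; Σ-syntax; ∃; ∃-syntax; _×_; _,_; proj₁; proj₂)
open import Data.Sum using (_⊎_)
open import Data.List using (List; length)
open import Data.List.Membership.Propositional using (_∈_)
open import Data.List.Relation.Unary.Unique.Propositional using (Unique)
open import Relation.Binary.PropositionalEquality using (_≡_; _≢_)
open import Relation.Nullary using (¬_)
open import Function.Bundles using (_⇔_)

-- A 2-element subset {a,b} of the m-set Fin m, stored canonically as (a , b) with a < b.
Pair : ℕ → Set
Pair m = Σ[ a ∈ Fin m ] Σ[ b ∈ Fin m ] (a < b)

_∈ₚ_ : {m : ℕ} → Fin m → Pair m → Set
x ∈ₚ (a , b , _) = (x ≡ a) ⊎ (x ≡ b)

KneserAdj : (m : ℕ) → Pair m → Pair m → Set
KneserAdj m u v = ∀ (x : Fin m) → ¬ (x ∈ₚ u × x ∈ₚ v)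

JohnsonAdj : (m : ℕ) → Pair m → Pair m → Set
JohnsonAdj m u v = Σ[ x ∈ Fin m ] ((x ∈ₚ u × x ∈ₚ v) × (∀ (y : Fin m) → y ∈ₚ u → y ∈ₚ v → y ≡ x))

ClosedNbhd : {V : Set} → (V → V → Set) → V → V → Set
ClosedNbhd Adj u w = (w ≡ u) ⊎ Adj u w

IsIdentifyingCode : {V : Set} → (V → V → Set) → List V → Set
IsIdentifyingCode {V} Adj C =
  Unique C
  × (∀ (u : V) → Σ[ c ∈ V ] (c ∈ C × ClosedNbhd Adj u c))
  × (∀ (u v : V) → u ≢ v →
       ¬ (∀ (c : V) → c ∈ C → (ClosedNbhd Adj u c ⇔ ClosedNbhd Adj v c)))

IsIDCodeNumber : {V : Set} → (V → V → Set) → ℕ → Set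
IsIDCodeNumber {V} Adj k =
  (Σ[ C ∈ List V ] (IsIdentifyingCode Adj C × length C ≡ k))
  × (∀ (C : List V) → IsIdentifyingCode Adj C → k Data.Nat.≤ length C)

-- A list C of 2-subsets of Fin m is a graph on Fin m, the code graph. If C identifies J(m,2) or
-- K(m,2), the code graph has at most one isolated vertex and no isolated edge; if it does have an
-- isolated vertex it has, in addition, no leaf (for J) or no path component a – y – b (for K).
-- Discharging then gives 2m ≤ 3|C|: without isolated vertices every edge pays at most 3 and every
-- vertex receives at least 2; with an isolated vertex, all other vertices have degree at least 2
-- (for J: m − 1 ≤ |C|), or receive at least 3 from edges paying at most 4 (for K: 3(m − 1) ≤ 4|C|,
-- which gives the claim for m ≥ 6 by integrality). Conversely, the star at a vertex (m − 1 edges)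
-- identifies K(m,2) and a Hamiltonian cycle (m edges) identifies J(m,2). Identifying codes being
-- decidable, a smallest one is found by exhaustive search over lists of pairs.

module Submission where

open import Defs
open import Data.Nat as ℕ using (ℕ; zero; suc; _≤_; _<_; _*_; _+_; _∸_; _%_; z≤n; s≤s)
open import Data.Nat.DivMod using (m%n<n; m<n⇒m%n≡m; [m+n]%n≡m%n; m%n%n≡m%n; %-distribˡ-+)
import Data.Nat.Properties as ℕₚ
open import Data.Fin as F using (Fin)
import Data.Fin.Properties as Fₚ
open import Data.Product using (Σ-syntax; ∃; _×_; _,_; proj₁; proj₂)
open import Data.Sum using (_⊎_; inj₁; inj₂; [_,_]′)
open import Data.Empty using (⊥; ⊥-elim)
open import Data.Bool using (Bool; true; false; if_then_else_; T)
open import Data.Unit using (tt)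
open import Function.Base using (_∘_; id)
open import Data.Nat.Tactic.RingSolver using (solve-∀)
open import Data.Nat.ListAction using (sum)
import Algebra.Properties.CommutativeMonoid.Sum ℕₚ.+-0-commutativeMonoid as ∑
open ∑ using (sum-syntax)
open import Data.List using (List; []; _∷_; length; map; concatMap; allFin; filter; lookup)
open import Data.List.Membership.Propositional using (_∈_; find; lose)
open import Data.List.Properties using (length-map; length-tabulate)
open import Data.List.Membership.Propositional.Properties using (∈-map⁺; ∈-concatMap⁺; ∈-allFin; ∈-filter⁺; ∈-filter⁻)
open import Data.List.Relation.Unary.Any as Any using (here; there)
open import Data.List.Relation.Unary.Any.Properties using (lookup-index)
import Data.List.Membership.DecPropositional as DecMembership
open import Data.List.Relation.Unary.All as All using (All; _∷_)
open import Data.List.Relation.Unary.AllPairs using (_∷_)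
open import Data.List.Relation.Unary.Unique.Propositional using (Unique)
import Data.List.Relation.Unary.Unique.Propositional.Properties as Uniqueₚ
import Data.List.Relation.Unary.Unique.DecPropositional as UniqueDec
open import Function.Bundles using (_⇔_; mk⇔; Equivalence)
import Function.Properties.Equivalence as ⇔
open import Relation.Nullary using (¬_; Dec; yes; no; does)
open import Relation.Nullary.Decidable using (_⊎-dec_; _×-dec_; _→-dec_; ¬?; map′; decidable-stable)
open import Relation.Binary.Definitions using (DecidableEquality; tri<; tri≈; tri>)
open import Relation.Binary.PropositionalEquality using (_≡_; _≢_; refl; sym; trans; cong; cong₂; subst; subst₂; ≢-sym; module ≡-Reasoning)

private variable m : ℕ

-- 2-subsets of Fin m

infix 4 _∈ₚ?_

_∈ₚ?_ : (x : Fin m) (u : Pair m) → Dec (x ∈ₚ u)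
x ∈ₚ? (a , b , _) = (x F.≟ a) ⊎-dec (x F.≟ b)

lo hi : Pair m → Fin m
lo (a , _ , _) = a
hi (_ , b , _) = b

lo∈ₚ : (u : Pair m) → lo u ∈ₚ u
lo∈ₚ _ = inj₁ refl

hi∈ₚ : (u : Pair m) → hi u ∈ₚ u
hi∈ₚ _ = inj₂ refl

lo≢hi : (u : Pair m) → lo u ≢ hi u
lo≢hi (_ , _ , a<b) = Fₚ.<⇒≢ a<b

≡-Pair : {u v : Pair m} → lo u ≡ lo v → hi u ≡ hi v → u ≡ v
≡-Pair {u = _ , _ , p} {_ , _ , q} refl refl = cong (λ r → _ , _ , r) (Fₚ.<-irrelevant p q)

∈ₚ-both : {x y : Fin m} (u : Pair m) → x ≢ y → x ∈ₚ u → y ∈ₚ u →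
          (x ≡ lo u × y ≡ hi u) ⊎ (x ≡ hi u × y ≡ lo u)
∈ₚ-both u x≢y (inj₁ p) (inj₁ q) = ⊥-elim (x≢y (trans p (sym q)))
∈ₚ-both u x≢y (inj₁ p) (inj₂ q) = inj₁ (p , q)
∈ₚ-both u x≢y (inj₂ p) (inj₁ q) = inj₂ (p , q)
∈ₚ-both u x≢y (inj₂ p) (inj₂ q) = ⊥-elim (x≢y (trans p (sym q)))

∈ₚ-only : {x y t : Fin m} (u : Pair m) → x ≢ y → x ∈ₚ u → y ∈ₚ u → t ∈ₚ u → t ≡ x ⊎ t ≡ y
∈ₚ-only u x≢y x∈u y∈u t∈u with ∈ₚ-both u x≢y x∈u y∈u | t∈u
... | inj₁ (x≡ , _) | inj₁ t≡ = inj₁ (trans t≡ (sym x≡))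
... | inj₁ (_ , y≡) | inj₂ t≡ = inj₂ (trans t≡ (sym y≡))
... | inj₂ (_ , y≡) | inj₁ t≡ = inj₂ (trans t≡ (sym y≡))
... | inj₂ (x≡ , _) | inj₂ t≡ = inj₁ (trans t≡ (sym x≡))

Pair-ext : {x y : Fin m} (u v : Pair m) → x ≢ y → x ∈ₚ u → y ∈ₚ u → x ∈ₚ v → y ∈ₚ v → u ≡ v
Pair-ext u@(_ , _ , p) v@(_ , _ , q) x≢y x∈u y∈u x∈v y∈v
  with ∈ₚ-both u x≢y x∈u y∈u | ∈ₚ-both v x≢y x∈v y∈v
... | inj₁ (refl , refl) | inj₁ (refl , refl) = ≡-Pair refl refl
... | inj₂ (refl , refl) | inj₂ (refl , refl) = ≡-Pair refl refl
... | inj₁ (refl , refl) | inj₂ (e₁ , e₂) = ⊥-elim (Fₚ.<-asym p (subst₂ F._<_ (sym e₂) (sym e₁) q))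
... | inj₂ (e₁ , e₂) | inj₁ (refl , refl) = ⊥-elim (Fₚ.<-asym q (subst₂ F._<_ (sym e₂) (sym e₁) p))

_≟ₚ_ : (u v : Pair m) → Dec (u ≡ v)
u ≟ₚ v with lo u F.≟ lo v | hi u F.≟ hi v
... | yes p | yes q = yes (≡-Pair p q)
... | no ¬p | _     = no λ { refl → ¬p refl }
... | yes _ | no ¬q = no λ { refl → ¬q refl }

opaque
  pair : (x y : Fin m) → x ≢ y → Pair m
  pair x y x≢y with Fₚ.<-cmp x y
  ... | tri< x<y _ _ = x , y , x<y
  ... | tri≈ _ x≡y _ = ⊥-elim (x≢y x≡y)
  ... | tri> _ _ y<x = y , x , y<x

  ∈ₚ-pairˡ : (x y : Fin m) (x≢y : x ≢ y) → x ∈ₚ pair x y x≢y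
  ∈ₚ-pairˡ x y x≢y with Fₚ.<-cmp x y
  ... | tri< _ _ _   = inj₁ refl
  ... | tri≈ _ x≡y _ = ⊥-elim (x≢y x≡y)
  ... | tri> _ _ _   = inj₂ refl

  ∈ₚ-pairʳ : (x y : Fin m) (x≢y : x ≢ y) → y ∈ₚ pair x y x≢y
  ∈ₚ-pairʳ x y x≢y with Fₚ.<-cmp x y
  ... | tri< _ _ _   = inj₂ refl
  ... | tri≈ _ x≡y _ = ⊥-elim (x≢y x≡y)
  ... | tri> _ _ _   = inj₁ refl

∈ₚ-pair⁻ : (x y : Fin m) (x≢y : x ≢ y) {t : Fin m} → t ∈ₚ pair x y x≢y → t ≡ x ⊎ t ≡ y
∈ₚ-pair⁻ x y x≢y = ∈ₚ-only (pair x y x≢y) x≢y (∈ₚ-pairˡ x y x≢y) (∈ₚ-pairʳ x y x≢y)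

∉ₚ-pair : {x y w : Fin m} (y≢w : y ≢ w) → x ≢ y → x ≢ w → ¬ x ∈ₚ pair y w y≢w
∉ₚ-pair y≢w x≢y x≢w x∈ with ∈ₚ-pair⁻ _ _ y≢w x∈
... | inj₁ x≡y = x≢y x≡y
... | inj₂ x≡w = x≢w x≡w

∃∈ₚ-other : {x : Fin m} (u : Pair m) → x ∈ₚ u → Σ[ y ∈ Fin m ] (y ∈ₚ u × y ≢ x)
∃∈ₚ-other u (inj₁ refl) = hi u , hi∈ₚ u , ≢-sym (lo≢hi u)
∃∈ₚ-other u (inj₂ refl) = lo u , lo∈ₚ u , lo≢hi u

∃∈ₚ-∖ : (u v : Pair m) → u ≢ v → Σ[ x ∈ Fin m ] (x ∈ₚ u × ¬ x ∈ₚ v)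
∃∈ₚ-∖ u v u≢v with lo u ∈ₚ? v | hi u ∈ₚ? v
... | no lo∉v | _       = lo u , lo∈ₚ u , lo∉v
... | yes _   | no hi∉v = hi u , hi∈ₚ u , hi∉v
... | yes lo∈v | yes hi∈v = ⊥-elim (u≢v (Pair-ext u v (lo≢hi u) (lo∈ₚ u) (hi∈ₚ u) lo∈v hi∈v))

private
  module FinMembership {m : ℕ} = DecMembership (Fₚ._≟_ {m})

  ∀∈⇒m≤length : (xs : List (Fin m)) → (∀ w → w ∈ xs) → m ≤ length xs
  ∀∈⇒m≤length xs every = ℕₚ.≮⇒≥ λ xs<m →
    let i , j , i<j , same-index = Fₚ.pigeonhole xs<m (Any.index ∘ every) in
    Fₚ.<⇒≢ i<j (begin
      i                               ≡⟨ lookup-index (every i) ⟩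
      lookup xs (Any.index (every i)) ≡⟨ cong (lookup xs) same-index ⟩
      lookup xs (Any.index (every j)) ≡⟨ lookup-index (every j) ⟨
      j                               ∎)
    where open ≡-Reasoning

  avoid : (xs : List (Fin m)) → length xs < m → Σ[ w ∈ Fin m ] ¬ w ∈ xs
  avoid xs xs<m with Fₚ.any? (λ w → ¬? (w FinMembership.∈? xs))
  ... | yes found = found
  ... | no  none  = ⊥-elim (ℕₚ.<⇒≱ xs<m (∀∈⇒m≤length xs λ w →
                      decidable-stable (w FinMembership.∈? xs) (λ w∉xs → none (w , w∉xs))))

  avoid₂ : (x y : Fin m) → 3 ≤ m → Σ[ w ∈ Fin m ] (x ≢ w × y ≢ w)
  avoid₂ x y 3≤m with avoid (x ∷ y ∷ []) 3≤m
  ... | w , w∉ = w , (λ x≡w → w∉ (here (sym x≡w))) , (λ y≡w → w∉ (there (here (sym y≡w))))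

Meets : Pair m → Pair m → Set
Meets u c = Σ[ w ∈ Fin _ ] (w ∈ₚ u × w ∈ₚ c)

johnsonN⇔Meets : {u c : Pair m} → ClosedNbhd (JohnsonAdj m) u c ⇔ Meets u c
johnsonN⇔Meets {u = u} {c} = mk⇔ to from
  where
  to : ClosedNbhd (JohnsonAdj _) u c → Meets u c
  to (inj₁ refl)                 = lo u , lo∈ₚ u , lo∈ₚ u
  to (inj₂ (w , (w∈u , w∈c) , _)) = w , w∈u , w∈c
  from : Meets u c → ClosedNbhd (JohnsonAdj _) u c
  from (w , w∈u , w∈c) with c ≟ₚ u
  ... | yes c≡u = inj₁ c≡u
  ... | no  c≢u = inj₂ (w , (w∈u , w∈c) , only-w)
    where
    only-w : ∀ y → y ∈ₚ u → y ∈ₚ c → y ≡ w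
    only-w y y∈u y∈c with y F.≟ w
    ... | yes y≡w = y≡w
    ... | no  y≢w = ⊥-elim (c≢u (Pair-ext c u y≢w y∈c w∈c y∈u w∈u))

-- Smallest identifying codes by exhaustive search

module _ {P : ℕ → Set} (P? : ∀ n → Dec (P n)) where

  private
    firstBelow : ∀ n → (∀ j → j < n → ¬ P j) ⊎ Σ[ k ∈ ℕ ] (P k × (∀ j → j < k → ¬ P j))
    firstBelow zero = inj₁ λ _ ()
    firstBelow (suc n) with firstBelow n
    ... | inj₂ first = inj₂ first
    ... | inj₁ none with P? n
    ...   | yes Pn = inj₂ (n , Pn , none)
    ...   | no ¬Pn = inj₁ none′
      where
      none′ : ∀ j → j < suc n → ¬ P j
      none′ j j<1+n with ℕₚ.m<1+n⇒m<n∨m≡n j<1+n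
      ... | inj₁ j<n  = none j j<n
      ... | inj₂ refl = ¬Pn

  least : ∀ {s} → P s → Σ[ k ∈ ℕ ] (P k × k ≤ s × (∀ j → P j → k ≤ j))
  least {s} Ps with firstBelow (suc s)
  ... | inj₁ none = ⊥-elim (none s (ℕₚ.n<1+n s) Ps)
  ... | inj₂ (k , Pk , below) = k , Pk , minimal Ps , λ _ → minimal
    where
    minimal : ∀ {j} → P j → k ≤ j
    minimal Pj = ℕₚ.≮⇒≥ λ j<k → below _ j<k Pj

module _ {V : Set} (_≟_ : DecidableEquality V) {vertices : List V} (∈-vertices : ∀ v → v ∈ vertices)
         {Adj : V → V → Set} (adj? : ∀ u v → Dec (Adj u v)) where

  private
    ∀? : {P : V → Set} → (∀ v → Dec (P v)) → Dec (∀ v → P v)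
    ∀? P? = map′ (λ all v → All.lookup all (∈-vertices v)) (λ ∀P → All.tabulate λ {v} _ → ∀P v)
                 (All.all? P? vertices)

    ∀∈? : (C : List V) {P : V → Set} → (∀ v → Dec (P v)) → Dec (∀ c → c ∈ C → P c)
    ∀∈? C P? = map′ (λ all c → All.lookup all) (λ ∀P → All.tabulate λ {c} → ∀P c) (All.all? P? C)

    ∃∈? : {A : Set} (C : List A) {P : A → Set} → (∀ a → Dec (P a)) → Dec (Σ[ c ∈ A ] (c ∈ C × P c))
    ∃∈? C P? = map′ find (λ (c , c∈C , Pc) → lose c∈C Pc) (Any.any? P? C)

    _⇔?_ : {A B : Set} → Dec A → Dec B → Dec (A ⇔ B)
    A? ⇔? B? = map′ (λ (to , from) → mk⇔ to from) (λ A⇔B → Equivalence.to A⇔B , Equivalence.from A⇔B)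
                    ((A? →-dec B?) ×-dec (B? →-dec A?))

    N? : ∀ u w → Dec (ClosedNbhd Adj u w)
    N? u w = (w ≟ u) ⊎-dec adj? u w

  isIdentifyingCode? : (C : List V) → Dec (IsIdentifyingCode Adj C)
  isIdentifyingCode? C =
    UniqueDec.unique? _≟_ C
    ×-dec ∀? (λ u → ∃∈? C (N? u))
    ×-dec ∀? (λ u → ∀? λ v → ¬? (u ≟ v) →-dec ¬? (∀∈? C λ c → N? u c ⇔? N? v c))

  listsOfLength : ℕ → List (List V)
  listsOfLength zero    = [] ∷ []
  listsOfLength (suc n) = concatMap (λ v → map (v ∷_) (listsOfLength n)) vertices

  ∈-listsOfLength : (C : List V) → C ∈ listsOfLength (length C)
  ∈-listsOfLength []      = here refl
  ∈-listsOfLength (c ∷ C) = ∈-concatMap⁺ (λ v → map (v ∷_) (listsOfLength (length C)))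
    (Any.map (λ { refl → ∈-map⁺ (c ∷_) (∈-listsOfLength C) }) (∈-vertices c))

  private
    codeOfSize? : ∀ n → Dec (Σ[ D ∈ List V ] (IsIdentifyingCode Adj D × length D ≡ n))
    codeOfSize? n = map′ (λ (D , _ , D-ok) → D , D-ok) (λ { (D , D-id , refl) → D , ∈-listsOfLength D , D-id , refl })
                         (∃∈? (listsOfLength n) λ D → isIdentifyingCode? D ×-dec (length D ℕ.≟ n))

  idCodeNumber-≤ : (C : List V) → IsIdentifyingCode Adj C →
                   Σ[ k ∈ ℕ ] (IsIDCodeNumber Adj k × k ≤ length C)
  idCodeNumber-≤ C C-id with least codeOfSize? (C , C-id , refl)
  ... | k , code , k≤ , minimal = k , (code , λ D D-id → minimal _ (D , D-id , refl)) , k≤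

private
  orderedPair : (a b : Fin m) → List (Pair m)
  orderedPair a b with a F.<? b
  ... | yes a<b = (a , b , a<b) ∷ []
  ... | no  _   = []

allPairs : (m : ℕ) → List (Pair m)
allPairs m = concatMap (λ a → concatMap (orderedPair a) (allFin m)) (allFin m)

∈-allPairs : (u : Pair m) → u ∈ allPairs m
∈-allPairs {m} (a , b , a<b) =
  ∈-concatMap⁺ (λ a → concatMap (orderedPair a) (allFin m))
    (Any.map (λ { refl → ∈-concatMap⁺ (orderedPair a) (Any.map (λ { refl → ∈-orderedPair }) (∈-allFin b)) })
             (∈-allFin a))
  where
  ∈-orderedPair : (a , b , a<b) ∈ orderedPair a b
  ∈-orderedPair with a F.<? b
  ... | yes _   = here (≡-Pair refl refl)
  ... | no  a≮b = ⊥-elim (a≮b a<b)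

kneser? : (u v : Pair m) → Dec (KneserAdj m u v)
kneser? u v = Fₚ.all? λ x → ¬? ((x ∈ₚ? u) ×-dec (x ∈ₚ? v))

johnson? : (u v : Pair m) → Dec (JohnsonAdj m u v)
johnson? u v = Fₚ.any? λ x → ((x ∈ₚ? u) ×-dec (x ∈ₚ? v))
                          ×-dec Fₚ.all? (λ y → (y ∈ₚ? u) →-dec (y ∈ₚ? v) →-dec (y F.≟ x))

-- The code graph

Isolated : List (Pair m) → Fin m → Set
Isolated C x = All (λ c → ¬ x ∈ₚ c) C

LeafEdge : List (Pair m) → Fin m → Pair m → Set
LeafEdge C x e = e ∈ C × x ∈ₚ e × (∀ c → c ∈ C → x ∈ₚ c → c ≡ e)

IsolatedEdge : List (Pair m) → Pair m → Set
IsolatedEdge C e = LeafEdge C (lo e) e × LeafEdge C (hi e) e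

isolated? : (C : List (Pair m)) (x : Fin m) → Dec (Isolated C x)
isolated? C x = All.all? (λ c → ¬? (x ∈ₚ? c)) C

isolated-≢ : {C : List (Pair m)} {z x : Fin m} {c : Pair m} → Isolated C z → c ∈ C → x ∈ₚ c → z ≢ x
isolated-≢ z-isolated c∈C x∈c refl = All.lookup z-isolated c∈C x∈c

incident : List (Pair m) → Fin m → List (Pair m)
incident C x = filter (x ∈ₚ?_) C

degree : List (Pair m) → Fin m → ℕ
degree C x = length (incident C x)

module _ {C : List (Pair m)} {x : Fin m} where

  ∈-incident⁺ : {c : Pair m} → c ∈ C → x ∈ₚ c → c ∈ incident C x
  ∈-incident⁺ = ∈-filter⁺ (x ∈ₚ?_)

  ∈-incident⁻ : {c : Pair m} → c ∈ incident C x → c ∈ C × x ∈ₚ c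
  ∈-incident⁻ = ∈-filter⁻ (x ∈ₚ?_)

module _ (C : List (Pair m)) (x : Fin m) where

  degree≡0⇒Isolated : degree C x ≡ 0 → Isolated C x
  degree≡0⇒Isolated d≡0 = All.tabulate λ c∈C x∈c → empty d≡0 (∈-incident⁺ c∈C x∈c)
    where
    empty : {D : List (Pair m)} {c : Pair m} → length D ≡ 0 → ¬ c ∈ D
    empty {[]} _ ()

  degree≡1⇒incident : degree C x ≡ 1 → Σ[ e ∈ Pair m ] (incident C x ≡ e ∷ [])
  degree≡1⇒incident d≡1 with incident C x
  ... | e ∷ [] = e , refl

  incident≡[e]⇒LeafEdge : {e : Pair m} → incident C x ≡ e ∷ [] → LeafEdge C x e
  incident≡[e]⇒LeafEdge {e} eq =
    proj₁ e-incident , proj₂ e-incident ,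
    λ c c∈C x∈c → only-e (subst (c ∈_) eq (∈-incident⁺ c∈C x∈c))
    where
    e-incident = ∈-incident⁻ (subst (e ∈_) (sym eq) (here refl))
    only-e : {c : Pair m} → c ∈ e ∷ [] → c ≡ e
    only-e (here c≡e) = c≡e

  degree≡1⇒LeafEdge : {e : Pair m} → degree C x ≡ 1 → e ∈ C → x ∈ₚ e → LeafEdge C x e
  degree≡1⇒LeafEdge {e} d≡1 e∈C x∈e with degree≡1⇒incident d≡1
  ... | _ , eq = e∈C , x∈e , λ c c∈C x∈c → trans (only c c∈C x∈c) (sym (only e e∈C x∈e))
    where only = proj₂ (proj₂ (incident≡[e]⇒LeafEdge eq))

  incident≡[e₁,e₂] : {e₁ e₂ : Pair m} → Unique C → incident C x ≡ e₁ ∷ e₂ ∷ [] →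
                     e₁ ≢ e₂ × (e₁ ∈ C × x ∈ₚ e₁) × (e₂ ∈ C × x ∈ₚ e₂) × (∀ c → c ∈ C → x ∈ₚ c → c ≡ e₁ ⊎ c ≡ e₂)
  incident≡[e₁,e₂] {e₁} {e₂} C-unique eq =
    e₁≢e₂ , ∈-incident⁻ (subst (e₁ ∈_) (sym eq) (here refl)) , ∈-incident⁻ (subst (e₂ ∈_) (sym eq) (there (here refl))) ,
    edges-at-x
    where
    e₁≢e₂ : e₁ ≢ e₂
    e₁≢e₂ with subst Unique eq (Uniqueₚ.filter⁺ (x ∈ₚ?_) C-unique)
    ... | (e₁≢e₂ ∷ _) ∷ _ = e₁≢e₂
    edges-at-x : ∀ c → c ∈ C → x ∈ₚ c → c ≡ e₁ ⊎ c ≡ e₂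
    edges-at-x c c∈C x∈c with subst (c ∈_) eq (∈-incident⁺ c∈C x∈c)
    ... | here c≡e₁         = inj₁ c≡e₁
    ... | there (here c≡e₂) = inj₂ c≡e₂

-- Discharging

received : (Fin m → Pair m → ℕ) → List (Pair m) → Fin m → ℕ
received r C x = sum (map (r x) (incident C x))

private
  ∑-mono-≤ : {f g : Fin m → ℕ} → (∀ x → f x ≤ g x) → ∑[ x < m ] f x ≤ ∑[ x < m ] g x
  ∑-mono-≤ {zero}  _   = z≤n
  ∑-mono-≤ {suc m} f≤g = ℕₚ.+-mono-≤ (f≤g F.zero) (∑-mono-≤ (f≤g ∘ F.suc))

  ∑-const : (k : ℕ) → ∑[ x < m ] k ≡ m * k
  ∑-const {zero}  k = refl
  ∑-const {suc m} k = cong (k +_) (∑-const {m} k)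

  ∑-indicator : (a : Fin m) (g : Fin m → ℕ) → ∑[ x < m ] (if does (x F.≟ a) then g x else 0) ≡ g a
  ∑-indicator {suc m} F.zero    g = trans (cong (g F.zero +_) (∑.sum-replicate-zero m)) (ℕₚ.+-identityʳ _)
  ∑-indicator {suc m} (F.suc a) g = ∑-indicator a (g ∘ F.suc)

  ∑-∈ₚ : (e : Pair m) (g : Fin m → ℕ) → ∑[ x < m ] (if does (x ∈ₚ? e) then g x else 0) ≡ g (lo e) + g (hi e)
  ∑-∈ₚ {m} e@(a , b , _) g = begin
    ∑[ x < m ] (if does (x ∈ₚ? e) then g x else 0)
      ≡⟨ ∑.sum-cong-≗ split ⟩
    ∑[ x < m ] ((if does (x F.≟ a) then g x else 0) + (if does (x F.≟ b) then g x else 0))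
      ≡⟨ ∑.∑-distrib-+ (λ x → if does (x F.≟ a) then g x else 0) (λ x → if does (x F.≟ b) then g x else 0) ⟩
    ∑[ x < m ] (if does (x F.≟ a) then g x else 0) + ∑[ x < m ] (if does (x F.≟ b) then g x else 0)
      ≡⟨ cong₂ _+_ (∑-indicator a g) (∑-indicator b g) ⟩
    g a + g b ∎
    where
    open ≡-Reasoning
    split : ∀ x → (if does (x ∈ₚ? e) then g x else 0)
                ≡ (if does (x F.≟ a) then g x else 0) + (if does (x F.≟ b) then g x else 0)
    split x with x F.≟ a | x F.≟ b
    ... | yes refl | yes refl = ⊥-elim (lo≢hi e refl)
    ... | yes _    | no  _    = sym (ℕₚ.+-identityʳ _)
    ... | no  _    | yes _    = refl
    ... | no  _    | no  _    = refl

  received-∷ : (r : Fin m → Pair m → ℕ) (c : Pair m) (C : List (Pair m)) (x : Fin m) →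
               received r (c ∷ C) x ≡ (if does (x ∈ₚ? c) then r x c else 0) + received r C x
  received-∷ r c C x with does (x ∈ₚ? c)
  ... | true  = refl
  ... | false = refl

  sum-map-≤ : {A : Set} (C : List A) (f : A → ℕ) (W : ℕ) → (∀ e → e ∈ C → f e ≤ W) → sum (map f C) ≤ length C * W
  sum-map-≤ []      f W _   = z≤n
  sum-map-≤ (c ∷ C) f W f≤W = ℕₚ.+-mono-≤ (f≤W c (here refl)) (sum-map-≤ C f W (λ e → f≤W e ∘ there))

∑-received : (r : Fin m → Pair m → ℕ) (C : List (Pair m)) →
             ∑[ x < m ] received r C x ≡ sum (map (λ e → r (lo e) e + r (hi e) e) C)
∑-received {m} r []      = ∑.sum-replicate-zero m
∑-received {m} r (c ∷ C) = begin
  ∑[ x < m ] received r (c ∷ C) x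
    ≡⟨ ∑.sum-cong-≗ (received-∷ r c C) ⟩
  ∑[ x < m ] ((if does (x ∈ₚ? c) then r x c else 0) + received r C x)
    ≡⟨ ∑.∑-distrib-+ (λ x → if does (x ∈ₚ? c) then r x c else 0) (received r C) ⟩
  ∑[ x < m ] (if does (x ∈ₚ? c) then r x c else 0) + ∑[ x < m ] received r C x
    ≡⟨ cong₂ _+_ (∑-∈ₚ c (λ x → r x c)) (∑-received r C) ⟩
  r (lo c) c + r (hi c) c + sum (map (λ e → r (lo e) e + r (hi e) e) C) ∎
  where open ≡-Reasoning

module _ (C : List (Pair m)) (r : Fin m → Pair m → ℕ) (W : ℕ)
         (paid≤W : ∀ e → e ∈ C → r (lo e) e + r (hi e) e ≤ W) where

  ∑-received-≤ : ∑[ x < m ] received r C x ≤ length C * W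
  ∑-received-≤ = subst (_≤ length C * W) (sym (∑-received r C)) (sum-map-≤ C _ W paid≤W)

  charging : (k : ℕ) → (∀ x → k ≤ received r C x) → m * k ≤ length C * W
  charging k k≤ = subst (_≤ length C * W) (∑-const {m} k) (ℕₚ.≤-trans (∑-mono-≤ k≤) ∑-received-≤)

  charging-except : (k : ℕ) (z : Fin m) → (∀ x → x ≢ z → k ≤ received r C x) → m * k ≤ length C * W + k
  charging-except k z k≤ = begin
    m * k                                                           ≡⟨ ∑-const {m} k ⟨
    ∑[ x < m ] k                                                    ≤⟨ ∑-mono-≤ k≤received+[z] ⟩
    ∑[ x < m ] (received r C x + (if does (x F.≟ z) then k else 0)) ≡⟨ ∑.∑-distrib-+ (received r C) (λ x → if does (x F.≟ z) then k else 0) ⟩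
    ∑[ x < m ] received r C x + ∑[ x < m ] (if does (x F.≟ z) then k else 0)
                                                                    ≡⟨ cong (_ +_) (∑-indicator z (λ _ → k)) ⟩
    ∑[ x < m ] received r C x + k                                   ≤⟨ ℕₚ.+-monoˡ-≤ k ∑-received-≤ ⟩
    length C * W + k                                                ∎
    where
    open ℕₚ.≤-Reasoning
    k≤received+[z] : ∀ x → k ≤ received r C x + (if does (x F.≟ z) then k else 0)
    k≤received+[z] x with x F.≟ z
    ... | yes _   = ℕₚ.m≤n+m k _
    ... | no  x≢z = ℕₚ.≤-trans (k≤ x x≢z) (ℕₚ.m≤m+n _ 0)

record P₃Component (C : List (Pair m)) (a y b : Fin m) : Set where
  field
    e₁ e₂      : Pair m
    e₁≢e₂      : e₁ ≢ e₂
    y∈e₁       : y ∈ₚ e₁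
    y∈e₂       : y ∈ₚ e₂
    edges-at-y : ∀ c → c ∈ C → y ∈ₚ c → c ≡ e₁ ⊎ c ≡ e₂
    leaf-a     : LeafEdge C a e₁
    leaf-b     : LeafEdge C b e₂

isLeaf : List (Pair m) → Fin m → Bool
isLeaf C x = degree C x ℕ.≡ᵇ 1

private
  true⊎false : (b : Bool) → b ≡ true ⊎ b ≡ false
  true⊎false true  = inj₁ refl
  true⊎false false = inj₂ refl

  length≤sum-map : {A : Set} (L : List A) (f : A → ℕ) → (∀ e → e ∈ L → 1 ≤ f e) → length L ≤ sum (map f L)
  length≤sum-map []      f _   = z≤n
  length≤sum-map (e ∷ L) f 1≤f = ℕₚ.+-mono-≤ (1≤f e (here refl)) (length≤sum-map L f (λ e′ → 1≤f e′ ∘ there))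

module _ (C : List (Pair m)) (x : Fin m) where

  isLeaf⇒degree≡1 : isLeaf C x ≡ true → degree C x ≡ 1
  isLeaf⇒degree≡1 leaf = ℕₚ.≡ᵇ⇒≡ _ 1 (subst T (sym leaf) tt)

  isLeaf⇒LeafEdge : {e : Pair m} → isLeaf C x ≡ true → e ∈ C → x ∈ₚ e → LeafEdge C x e
  isLeaf⇒LeafEdge = degree≡1⇒LeafEdge C x ∘ isLeaf⇒degree≡1

  2≤degree : ¬ Isolated C x → isLeaf C x ≡ false → 2 ≤ degree C x
  2≤degree ¬isolated ¬leaf = atLeast2 (degree C x) (¬isolated ∘ degree≡0⇒Isolated C x) ¬degree≡1
    where
    ¬degree≡1 : degree C x ≢ 1
    ¬degree≡1 d≡1 = subst T ¬leaf (ℕₚ.≡⇒≡ᵇ _ 1 d≡1)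
    atLeast2 : ∀ d → d ≢ 0 → d ≢ 1 → 2 ≤ d
    atLeast2 0             d≢0 _   = ⊥-elim (d≢0 refl)
    atLeast2 1             _   d≢1 = ⊥-elim (d≢1 refl)
    atLeast2 (suc (suc _)) _   _   = s≤s (s≤s z≤n)

  module _ (r : Fin m → Pair m → ℕ) where

    received-[e] : {e : Pair m} → incident C x ≡ e ∷ [] → received r C x ≡ r x e
    received-[e] eq = trans (cong (sum ∘ map (r x)) eq) (ℕₚ.+-identityʳ _)

    received-[e₁,e₂] : {e₁ e₂ : Pair m} → incident C x ≡ e₁ ∷ e₂ ∷ [] → received r C x ≡ r x e₁ + r x e₂
    received-[e₁,e₂] eq = trans (cong (sum ∘ map (r x)) eq) (cong (r x _ +_) (ℕₚ.+-identityʳ _))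

    degree≤received : (∀ e → e ∈ C → 1 ≤ r x e) → degree C x ≤ received r C x
    degree≤received 1≤r = length≤sum-map (incident C x) (r x) (λ e → 1≤r e ∘ proj₁ ∘ ∈-incident⁻)

isLeaf≡false : (C : List (Pair m)) (x : Fin m) → (∀ e → ¬ LeafEdge C x e) → isLeaf C x ≡ false
isLeaf≡false C x ¬leafEdge with true⊎false (isLeaf C x)
... | inj₂ ¬leaf = ¬leaf
... | inj₁ leaf  = let e , eq = degree≡1⇒incident C x (isLeaf⇒degree≡1 C x leaf) in
                   ⊥-elim (¬leafEdge e (incident≡[e]⇒LeafEdge C x eq))

leaves⇒IsolatedEdge : {C : List (Pair m)} {e : Pair m} → e ∈ C → isLeaf C (lo e) ≡ true → isLeaf C (hi e) ≡ true →
                      IsolatedEdge C e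
leaves⇒IsolatedEdge {C = C} {e} e∈C lo-leaf hi-leaf =
  isLeaf⇒LeafEdge C (lo e) lo-leaf e∈C (lo∈ₚ e) , isLeaf⇒LeafEdge C (hi e) hi-leaf e∈C (hi∈ₚ e)

two-thirds-bound : (C : List (Pair m)) → (∀ x → ¬ Isolated C x) → (∀ e → e ∈ C → ¬ IsolatedEdge C e) →
                   2 * m ≤ 3 * length C
two-thirds-bound {m} C ¬isolated ¬isolatedEdge =
  subst₂ _≤_ (ℕₚ.*-comm m 2) (ℕₚ.*-comm (length C) 3) (charging C weight 3 paid≤3 2 2≤received)
  where
  weight : Fin m → Pair m → ℕ
  weight x _ = if isLeaf C x then 2 else 1

  paid≤3 : ∀ e → e ∈ C → (if isLeaf C (lo e) then 2 else 1) + (if isLeaf C (hi e) then 2 else 1) ≤ 3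
  paid≤3 e e∈C with isLeaf C (lo e) in lo-leaf | isLeaf C (hi e) in hi-leaf
  ... | true  | true  = ⊥-elim (¬isolatedEdge e e∈C (leaves⇒IsolatedEdge e∈C lo-leaf hi-leaf))
  ... | true  | false = ℕₚ.≤-refl
  ... | false | true  = ℕₚ.≤-refl
  ... | false | false = s≤s (s≤s z≤n)

  2≤received : ∀ x → 2 ≤ received weight C x
  2≤received x with true⊎false (isLeaf C x)
  ... | inj₁ leaf = let e , eq = degree≡1⇒incident C x (isLeaf⇒degree≡1 C x leaf) in
                subst (2 ≤_) (sym (received-[e] C x weight eq)) (subst (λ b → 2 ≤ (if b then 2 else 1)) (sym leaf) ℕₚ.≤-refl)
  ... | inj₂ ¬leaf = ℕₚ.≤-trans (2≤degree C x (¬isolated x) ¬leaf) (degree≤received C x weight λ _ _ → 1≤weight (isLeaf C x))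
    where
    1≤weight : ∀ b → 1 ≤ (if b then 2 else 1)
    1≤weight true  = s≤s z≤n
    1≤weight false = s≤s z≤n

handshake-except : (C : List (Pair m)) (z : Fin m) → (∀ x → x ≢ z → 2 ≤ degree C x) → m ≤ length C + 1
handshake-except {m} C z 2≤degree =
  ℕₚ.*-cancelʳ-≤ m (length C + 1) 2
    (subst (m * 2 ≤_) (sym (ℕₚ.*-distribʳ-+ 2 (length C) 1))
      (charging-except C (λ _ _ → 1) 2 (λ _ _ → ℕₚ.≤-refl) 2 z
        λ x x≢z → ℕₚ.≤-trans (2≤degree x x≢z) (degree≤received C x (λ _ _ → 1) (λ _ _ → ℕₚ.≤-refl))))

module _ (C : List (Pair m)) (C-unique : Unique C) (z : Fin m) (¬isolated : ∀ x → x ≢ z → ¬ Isolated C x)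
         (¬isolatedEdge : ∀ e → e ∈ C → ¬ IsolatedEdge C e) (¬P₃ : ∀ {a y b} → ¬ P₃Component C a y b) where

  private
    ind : Bool → ℕ
    ind b = if b then 1 else 0

    leaves : Pair m → ℕ
    leaves e = ind (isLeaf C (lo e)) + ind (isLeaf C (hi e))

    -- A leaf takes 3 from its edge; any other vertex takes 1 from an edge whose far end is a leaf, 2 otherwise.
    weight : Fin m → Pair m → ℕ
    weight x e = if isLeaf C x then 3 else 2 ∸ leaves e

    paid≤4 : ∀ e → e ∈ C →
             (if isLeaf C (lo e) then 3 else 2 ∸ (ind (isLeaf C (lo e)) + ind (isLeaf C (hi e))))
             + (if isLeaf C (hi e) then 3 else 2 ∸ (ind (isLeaf C (lo e)) + ind (isLeaf C (hi e)))) ≤ 4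
    paid≤4 e e∈C with isLeaf C (lo e) in lo-leaf | isLeaf C (hi e) in hi-leaf
    ... | true  | true  = ⊥-elim (¬isolatedEdge e e∈C (leaves⇒IsolatedEdge e∈C lo-leaf hi-leaf))
    ... | true  | false = ℕₚ.≤-refl
    ... | false | true  = ℕₚ.≤-refl
    ... | false | false = ℕₚ.≤-refl

    leaves≤1 : ∀ e → e ∈ C → ind (isLeaf C (lo e)) + ind (isLeaf C (hi e)) ≤ 1
    leaves≤1 e e∈C with isLeaf C (lo e) in lo-leaf | isLeaf C (hi e) in hi-leaf
    ... | true  | true  = ⊥-elim (¬isolatedEdge e e∈C (leaves⇒IsolatedEdge e∈C lo-leaf hi-leaf))
    ... | true  | false = ℕₚ.≤-refl
    ... | false | true  = ℕₚ.≤-refl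
    ... | false | false = z≤n

    1≤weight : ∀ x e → e ∈ C → 1 ≤ weight x e
    1≤weight x e e∈C with isLeaf C x
    ... | true  = s≤s z≤n
    ... | false = ℕₚ.∸-monoʳ-≤ 2 (leaves≤1 e e∈C)

    weight-at-nonLeaf : ∀ {x e} → isLeaf C x ≡ false → x ∈ₚ e →
                        Σ[ y ∈ Fin m ] (y ∈ₚ e × weight x e ≡ 2 ∸ ind (isLeaf C y))
    weight-at-nonLeaf {e = e} ¬leaf (inj₁ refl) =
      hi e , hi∈ₚ e , cong (λ b → if b then 3 else 2 ∸ (ind b + ind (isLeaf C (hi e)))) ¬leaf
    weight-at-nonLeaf {e = e} ¬leaf (inj₂ refl) =
      lo e , lo∈ₚ e , trans (cong (λ b → if b then 3 else 2 ∸ (ind (isLeaf C (lo e)) + ind b)) ¬leaf)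
                            (cong (2 ∸_) (ℕₚ.+-identityʳ (ind (isLeaf C (lo e)))))

    3≤2∸+2∸ : ∀ b₁ b₂ → (b₁ ≡ true → b₂ ≡ true → ⊥) → 3 ≤ (2 ∸ ind b₁) + (2 ∸ ind b₂)
    3≤2∸+2∸ true  true  ¬both = ⊥-elim (¬both refl refl)
    3≤2∸+2∸ true  false _     = ℕₚ.≤-refl
    3≤2∸+2∸ false true  _     = ℕₚ.≤-refl
    3≤2∸+2∸ false false _     = s≤s (s≤s (s≤s z≤n))

    3≤received-degree2 : ∀ {x e₁ e₂} → isLeaf C x ≡ false → incident C x ≡ e₁ ∷ e₂ ∷ [] → 3 ≤ received weight C x
    3≤received-degree2 {x} {e₁} {e₂} ¬leaf eq with incident≡[e₁,e₂] C x C-unique eq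
    ... | e₁≢e₂ , (e₁∈C , x∈e₁) , (e₂∈C , x∈e₂) , edges-at-x
      with weight-at-nonLeaf {x} {e₁} ¬leaf x∈e₁ | weight-at-nonLeaf {x} {e₂} ¬leaf x∈e₂
    ...   | y₁ , y₁∈e₁ , weight₁ | y₂ , y₂∈e₂ , weight₂ =
      subst (3 ≤_) (sym (trans (received-[e₁,e₂] C x weight eq) (cong₂ _+_ weight₁ weight₂)))
            (3≤2∸+2∸ (isLeaf C y₁) (isLeaf C y₂) λ leaf₁ leaf₂ → ¬P₃ record
              { e₁ = e₁ ; e₂ = e₂ ; e₁≢e₂ = e₁≢e₂ ; y∈e₁ = x∈e₁ ; y∈e₂ = x∈e₂ ; edges-at-y = edges-at-x
              ; leaf-a = isLeaf⇒LeafEdge C y₁ leaf₁ e₁∈C y₁∈e₁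
              ; leaf-b = isLeaf⇒LeafEdge C y₂ leaf₂ e₂∈C y₂∈e₂ })

    3≤received : ∀ x → x ≢ z → 3 ≤ received weight C x
    3≤received x x≢z with true⊎false (isLeaf C x)
    ... | inj₁ leaf = let e , eq = degree≡1⇒incident C x (isLeaf⇒degree≡1 C x leaf) in
                      subst (3 ≤_) (sym (received-[e] C x weight eq)) (subst (λ b → 3 ≤ (if b then 3 else 2 ∸ leaves e)) (sym leaf) ℕₚ.≤-refl)
    ... | inj₂ ¬leaf with degree C x ℕ.≟ 2
    ...   | yes d≡2 = let (e₁ , e₂ , eq) = two-edges d≡2 in 3≤received-degree2 ¬leaf eq
      where
      two-edges : degree C x ≡ 2 → Σ[ e₁ ∈ Pair m ] Σ[ e₂ ∈ Pair m ] (incident C x ≡ e₁ ∷ e₂ ∷ [])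
      two-edges d≡2 with incident C x
      ... | e₁ ∷ e₂ ∷ [] = e₁ , e₂ , refl
    ...   | no  d≢2 = ℕₚ.≤-trans (3≤degree (2≤degree C x (¬isolated x x≢z) ¬leaf))
                                 (degree≤received C x weight (1≤weight x))
      where
      3≤degree : 2 ≤ degree C x → 3 ≤ degree C x
      3≤degree 2≤d with ℕₚ.m≤n⇒m<n∨m≡n 2≤d
      ... | inj₁ 2<d  = 2<d
      ... | inj₂ 2≡d  = ⊥-elim (d≢2 (sym 2≡d))

  three-quarters-bound : m * 3 ≤ length C * 4 + 3
  three-quarters-bound = charging-except C weight 4 paid≤4 3 z 3≤received

private
  m≤c+1⇒2m≤3c : ∀ {m c} → 3 ≤ m → m ≤ c + 1 → 2 * m ≤ 3 * c
  m≤c+1⇒2m≤3c {m} {c} 3≤m m≤c+1 = ℕₚ.+-cancelʳ-≤ 3 (2 * m) (3 * c) (begin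
    2 * m + 3   ≤⟨ ℕₚ.+-monoʳ-≤ (2 * m) 3≤m ⟩
    2 * m + m   ≡⟨ ℕₚ.+-comm (2 * m) m ⟩
    3 * m       ≤⟨ ℕₚ.*-monoʳ-≤ 3 m≤c+1 ⟩
    3 * (c + 1) ≡⟨ ℕₚ.*-distribˡ-+ 3 c 1 ⟩
    3 * c + 3   ∎)
    where open ℕₚ.≤-Reasoning

  9m≡3[m*3] : ∀ m → m + 4 * (2 * m) ≡ 3 * (m * 3)
  9m≡3[m*3] = solve-∀

  3[c*4+3]≡4[1+3c]+5 : ∀ c → 3 * (c * 4 + 3) ≡ 4 * suc (3 * c) + 5
  3[c*4+3]≡4[1+3c]+5 = solve-∀

  m*3≤c*4+3⇒2m≤3c : ∀ {m c} → 6 ≤ m → m * 3 ≤ c * 4 + 3 → 2 * m ≤ 3 * c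
  m*3≤c*4+3⇒2m≤3c {m} {c} 6≤m m*3≤ with 2 * m ℕ.≤? 3 * c
  ... | yes 2m≤3c = 2m≤3c
  ... | no  2m≰3c = ⊥-elim (ℕₚ.<⇒≱ (s≤s m≤5) 6≤m)
    where
    open ℕₚ.≤-Reasoning
    m≤5 : m ≤ 5
    m≤5 = ℕₚ.+-cancelʳ-≤ (4 * (2 * m)) m 5 (begin
      m + 4 * (2 * m)   ≡⟨ 9m≡3[m*3] m ⟩
      3 * (m * 3)       ≤⟨ ℕₚ.*-monoʳ-≤ 3 m*3≤ ⟩
      3 * (c * 4 + 3)   ≡⟨ 3[c*4+3]≡4[1+3c]+5 c ⟩
      4 * suc (3 * c) + 5 ≤⟨ ℕₚ.+-monoˡ-≤ 5 (ℕₚ.*-monoʳ-≤ 4 (ℕₚ.≰⇒> 2m≰3c)) ⟩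
      4 * (2 * m) + 5   ≡⟨ ℕₚ.+-comm (4 * (2 * m)) 5 ⟩
      5 + 4 * (2 * m)   ∎)

-- Configurations excluded by identifying codes

separation : {V : Set} {Adj : V → V → Set} {C : List V} → IsIdentifyingCode Adj C → {u v : V} → u ≢ v →
             (∀ c → c ∈ C → ClosedNbhd Adj u c → ClosedNbhd Adj v c) →
             (∀ c → c ∈ C → ClosedNbhd Adj v c → ClosedNbhd Adj u c) → ⊥
separation (_ , _ , separating) u≢v to from = separating _ _ u≢v λ c c∈C → mk⇔ (to c c∈C) (from c c∈C)

Covers : List (Pair m) → Pair m → Pair m → Set
Covers C u v = ∀ c → c ∈ C → Meets u c → Meets v c

Reaches : List (Pair m) → Fin m → Pair m → Set
Reaches C x v = ∀ c → c ∈ C → x ∈ₚ c → Meets v c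

module _ {C : List (Pair m)} (v : Pair m) where

  Reaches-∈ : {x : Fin m} → x ∈ₚ v → Reaches C x v
  Reaches-∈ {x} x∈v _ _ x∈c = x , x∈v , x∈c

  Reaches-isolated : {x : Fin m} → Isolated C x → Reaches C x v
  Reaches-isolated x-isolated c c∈C x∈c = ⊥-elim (All.lookup x-isolated c∈C x∈c)

  Reaches-leaf : {x : Fin m} {e : Pair m} → (∀ c → c ∈ C → x ∈ₚ c → c ≡ e) → Meets v e → Reaches C x v
  Reaches-leaf only-e v-meets-e c c∈C x∈c = subst (Meets v) (sym (only-e c c∈C x∈c)) v-meets-e

  Covers-two : {x y : Fin m} (u : Pair m) → x ≢ y → x ∈ₚ u → y ∈ₚ u → Reaches C x v → Reaches C y v → Covers C u v
  Covers-two u x≢y x∈u y∈u x-reaches y-reaches c c∈C (t , t∈u , t∈c) with ∈ₚ-only u x≢y x∈u y∈u t∈u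
  ... | inj₁ refl = x-reaches c c∈C t∈c
  ... | inj₂ refl = y-reaches c c∈C t∈c

  Covers-pair : {x y : Fin m} (x≢y : x ≢ y) → Reaches C x v → Reaches C y v → Covers C (pair x y x≢y) v
  Covers-pair x≢y = Covers-two (pair _ _ x≢y) x≢y (∈ₚ-pairˡ _ _ x≢y) (∈ₚ-pairʳ _ _ x≢y)

module _ {C : List (Pair m)} (C-id : IsIdentifyingCode (JohnsonAdj m) C) where

  private
    johnson-separation : {u v : Pair m} → u ≢ v → Covers C u v → Covers C v u → ⊥
    johnson-separation u≢v u⊑v v⊑u = separation C-id u≢v
      (λ c c∈C → Equivalence.from johnsonN⇔Meets ∘ u⊑v c c∈C ∘ Equivalence.to johnsonN⇔Meets)
      (λ c c∈C → Equivalence.from johnsonN⇔Meets ∘ v⊑u c c∈C ∘ Equivalence.to johnsonN⇔Meets)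

  johnson-¬IsolatedEdge : 3 ≤ m → ∀ e → e ∈ C → ¬ IsolatedEdge C e
  johnson-¬IsolatedEdge 3≤m e e∈C ((_ , _ , only-lo) , (_ , _ , only-hi)) with avoid₂ (lo e) (hi e) 3≤m
  ... | w , lo≢w , hi≢w =
    johnson-separation u≢v
      (Covers-pair v lo≢w (Reaches-leaf v only-lo (hi e , ∈ₚ-pairˡ _ _ hi≢w , hi∈ₚ e)) (Reaches-∈ v (∈ₚ-pairʳ _ _ hi≢w)))
      (Covers-pair u hi≢w (Reaches-leaf u only-hi (lo e , ∈ₚ-pairˡ _ _ lo≢w , lo∈ₚ e)) (Reaches-∈ u (∈ₚ-pairʳ _ _ lo≢w)))
    where
    u = pair (lo e) w lo≢w
    v = pair (hi e) w hi≢w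
    u≢v : u ≢ v
    u≢v u≡v = ∉ₚ-pair hi≢w (lo≢hi e) lo≢w (subst (lo e ∈ₚ_) u≡v (∈ₚ-pairˡ _ _ lo≢w))

  johnson-isolated-unique : {z z′ : Fin m} → Isolated C z → Isolated C z′ → z ≡ z′
  johnson-isolated-unique {z} {z′} z-isolated z′-isolated with z F.≟ z′
  ... | yes z≡z′ = z≡z′
  ... | no  z≢z′ with proj₁ (proj₂ C-id) (pair z z′ z≢z′)
  ...   | c , c∈C , N[zz′]∋c with Equivalence.to johnsonN⇔Meets N[zz′]∋c
  ...     | t , t∈zz′ , t∈c with ∈ₚ-pair⁻ z z′ z≢z′ t∈zz′
  ...       | inj₁ refl = ⊥-elim (All.lookup z-isolated c∈C t∈c)
  ...       | inj₂ refl = ⊥-elim (All.lookup z′-isolated c∈C t∈c)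

  johnson-isolated⇒¬LeafEdge : {z x : Fin m} {e : Pair m} → Isolated C z → ¬ LeafEdge C x e
  johnson-isolated⇒¬LeafEdge {z} {x} {e} z-isolated (e∈C , x∈e , only-e) with ∃∈ₚ-other e x∈e
  ... | y , y∈e , y≢x =
    johnson-separation u≢v
      (Covers-pair v x≢y (Reaches-leaf v only-e (y , ∈ₚ-pairʳ _ _ z≢y , y∈e)) (Reaches-∈ v (∈ₚ-pairʳ _ _ z≢y)))
      (Covers-pair u z≢y (Reaches-isolated u z-isolated) (Reaches-∈ u (∈ₚ-pairʳ _ _ x≢y)))
    where
    x≢y = ≢-sym y≢x
    z≢y = isolated-≢ z-isolated e∈C y∈e
    u = pair x y x≢y
    v = pair z y z≢y
    u≢v : u ≢ v
    u≢v u≡v = ∉ₚ-pair z≢y (≢-sym (isolated-≢ z-isolated e∈C x∈e)) x≢y (subst (x ∈ₚ_) u≡v (∈ₚ-pairˡ _ _ x≢y))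

johnson-lower-bound : 3 ≤ m → (C : List (Pair m)) → IsIdentifyingCode (JohnsonAdj m) C → 2 * m ≤ 3 * length C
johnson-lower-bound 3≤m C C-id with Fₚ.any? (isolated? C)
... | no  none            = two-thirds-bound C (λ x x-isolated → none (x , x-isolated)) (johnson-¬IsolatedEdge C-id 3≤m)
... | yes (z , z-isolated) = m≤c+1⇒2m≤3c 3≤m (handshake-except C z λ x x≢z →
  2≤degree C x (λ x-isolated → x≢z (johnson-isolated-unique C-id x-isolated z-isolated))
               (isLeaf≡false C x λ e → johnson-isolated⇒¬LeafEdge C-id z-isolated))

kneser-N⊆ : {C : List (Pair m)} {u v : Pair m} → (u ∈ C → ClosedNbhd (KneserAdj m) v u) →
            (∀ c → c ∈ C → c ≢ v → Meets v c → Meets u c) →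
            ∀ c → c ∈ C → ClosedNbhd (KneserAdj m) u c → ClosedNbhd (KneserAdj m) v c
kneser-N⊆ at-u _ c c∈C (inj₁ refl) = at-u c∈C
kneser-N⊆ {v = v} _ v⊑u c c∈C (inj₂ u∩c=∅) with c ≟ₚ v
... | yes c≡v = inj₁ c≡v
... | no  c≢v = inj₂ λ t (t∈v , t∈c) →
  let s , s∈u , s∈c = v⊑u c c∈C c≢v (t , t∈v , t∈c) in u∩c=∅ s (s∈u , s∈c)

module _ {C : List (Pair m)} (C-id : IsIdentifyingCode (KneserAdj m) C) where

  kneser-¬IsolatedEdge : 3 ≤ m → ∀ e → e ∈ C → ¬ IsolatedEdge C e
  kneser-¬IsolatedEdge 3≤m e e∈C ((_ , _ , only-lo) , (_ , _ , only-hi)) with avoid₂ (lo e) (hi e) 3≤m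
  ... | w , lo≢w , hi≢w =
    separation C-id u≢v
      (kneser-N⊆ (⊥-elim ∘ pair∉C only-lo lo≢w) λ c c∈C _ →
        Covers-pair u hi≢w (Reaches-leaf u only-hi (lo e , ∈ₚ-pairˡ _ _ lo≢w , lo∈ₚ e)) (Reaches-∈ u (∈ₚ-pairʳ _ _ lo≢w)) c c∈C)
      (kneser-N⊆ (⊥-elim ∘ pair∉C only-hi hi≢w) λ c c∈C _ →
        Covers-pair v lo≢w (Reaches-leaf v only-lo (hi e , ∈ₚ-pairˡ _ _ hi≢w , hi∈ₚ e)) (Reaches-∈ v (∈ₚ-pairʳ _ _ hi≢w)) c c∈C)
    where
    u = pair (lo e) w lo≢w
    v = pair (hi e) w hi≢w
    u≢v : u ≢ v
    u≢v u≡v = ∉ₚ-pair hi≢w (lo≢hi e) lo≢w (subst (lo e ∈ₚ_) u≡v (∈ₚ-pairˡ _ _ lo≢w))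
    pair∉C : {x : Fin m} → (∀ c → c ∈ C → x ∈ₚ c → c ≡ e) → (x≢w : x ≢ w) → ¬ pair x w x≢w ∈ C
    pair∉C only-e x≢w xw∈C with subst (w ∈ₚ_) (only-e _ xw∈C (∈ₚ-pairˡ _ _ x≢w)) (∈ₚ-pairʳ _ _ x≢w)
    ... | inj₁ w≡lo = lo≢w (sym w≡lo)
    ... | inj₂ w≡hi = hi≢w (sym w≡hi)

  kneser-isolated-unique : 3 ≤ m → {z z′ : Fin m} → Isolated C z → Isolated C z′ → z ≡ z′
  kneser-isolated-unique 3≤m {z} {z′} z-isolated z′-isolated with z F.≟ z′
  ... | yes z≡z′ = z≡z′
  ... | no  z≢z′ with avoid₂ z z′ 3≤m
  ...   | x , z≢x , z′≢x = ⊥-elim (separation C-id u≢v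
    (kneser-N⊆ (λ u∈C → ⊥-elim (All.lookup z-isolated u∈C (∈ₚ-pairˡ _ _ z≢x))) λ c c∈C _ →
      Covers-pair u z′≢x (Reaches-isolated u z′-isolated) (Reaches-∈ u (∈ₚ-pairʳ _ _ z≢x)) c c∈C)
    (kneser-N⊆ (λ v∈C → ⊥-elim (All.lookup z′-isolated v∈C (∈ₚ-pairˡ _ _ z′≢x))) λ c c∈C _ →
      Covers-pair v z≢x (Reaches-isolated v z-isolated) (Reaches-∈ v (∈ₚ-pairʳ _ _ z′≢x)) c c∈C))
    where
    u = pair z x z≢x
    v = pair z′ x z′≢x
    u≢v : u ≢ v
    u≢v u≡v = ∉ₚ-pair z′≢x z≢z′ z≢x (subst (z ∈ₚ_) u≡v (∈ₚ-pairˡ _ _ z≢x))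

  kneser-isolated⇒¬P₃Component : {z a y b : Fin m} → Isolated C z → ¬ P₃Component C a y b
  kneser-isolated⇒¬P₃Component {z} {a} {y} {b} z-isolated record
    { e₁ = e₁ ; e₂ = e₂ ; e₁≢e₂ = e₁≢e₂ ; y∈e₁ = y∈e₁ ; y∈e₂ = y∈e₂ ; edges-at-y = edges-at-y
    ; leaf-a = (e₁∈C , a∈e₁ , only-a) ; leaf-b = (e₂∈C , b∈e₂ , only-b) } =
    separation C-id u≢e₂
      (kneser-N⊆ (λ u∈C → ⊥-elim (z∉ u∈C (∈ₚ-pairʳ _ _ a≢z))) e₂⊑u)
      (kneser-N⊆ (λ _ → inj₂ u∩e₂=∅) λ c c∈C _ →
        Covers-pair e₂ a≢z (Reaches-leaf e₂ only-a (y , y∈e₂ , y∈e₁)) (Reaches-isolated e₂ z-isolated) c c∈C)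
    where
    z∉ : {c : Pair m} → c ∈ C → ¬ z ∈ₚ c
    z∉ = All.lookup z-isolated
    a≢z : a ≢ z
    a≢z = ≢-sym (isolated-≢ z-isolated e₁∈C a∈e₁)
    y≢b : y ≢ b
    y≢b refl = e₁≢e₂ (only-b e₁ e₁∈C y∈e₁)
    u = pair a z a≢z
    u≢e₂ : u ≢ e₂
    u≢e₂ u≡e₂ = z∉ e₂∈C (subst (z ∈ₚ_) u≡e₂ (∈ₚ-pairʳ _ _ a≢z))
    u∩e₂=∅ : KneserAdj m u e₂
    u∩e₂=∅ t (t∈u , t∈e₂) with ∈ₚ-pair⁻ a z a≢z t∈u
    ... | inj₁ refl = e₁≢e₂ (sym (only-a e₂ e₂∈C t∈e₂))
    ... | inj₂ refl = z∉ e₂∈C t∈e₂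
    e₂⊑u : ∀ c → c ∈ C → c ≢ e₂ → Meets e₂ c → Meets u c
    e₂⊑u c c∈C c≢e₂ (t , t∈e₂ , t∈c) with ∈ₚ-only e₂ y≢b y∈e₂ b∈e₂ t∈e₂
    ... | inj₂ refl = ⊥-elim (c≢e₂ (only-b c c∈C t∈c))
    ... | inj₁ refl with edges-at-y c c∈C t∈c
    ...   | inj₁ refl = a , ∈ₚ-pairˡ _ _ a≢z , a∈e₁
    ...   | inj₂ c≡e₂ = ⊥-elim (c≢e₂ c≡e₂)

kneser-lower-bound : 6 ≤ m → (C : List (Pair m)) → IsIdentifyingCode (KneserAdj m) C → 2 * m ≤ 3 * length C
kneser-lower-bound {m} 6≤m C C-id = by-isolated (Fₚ.any? (isolated? C))
  where
  3≤m : 3 ≤ m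
  3≤m = ℕₚ.≤-trans (ℕₚ.m≤m+n 3 3) 6≤m
  by-isolated : Dec (∃ (Isolated C)) → 2 * m ≤ 3 * length C
  by-isolated (no  none)             = two-thirds-bound C (λ x x-isolated → none (x , x-isolated))
                                                          (kneser-¬IsolatedEdge C-id 3≤m)
  by-isolated (yes (z , z-isolated)) = m*3≤c*4+3⇒2m≤3c {c = length C} 6≤m (three-quarters-bound C (proj₁ C-id) z
    (λ x x≢z x-isolated → x≢z (kneser-isolated-unique C-id 3≤m x-isolated z-isolated))
    (kneser-¬IsolatedEdge C-id 3≤m) (kneser-isolated⇒¬P₃Component C-id z-isolated))

-- Identifying codes with at most m edges

module Star (n : ℕ) where

  star : Fin n → Pair (suc n)
  star t = F.zero , F.suc t , s≤s z≤n

  starCode : List (Pair (suc n))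
  starCode = map star (allFin n)

  length-starCode : length starCode ≡ n
  length-starCode = trans (length-map star (allFin n)) (length-tabulate id)

  starCode-unique : Unique starCode
  starCode-unique = Uniqueₚ.map⁺ (λ eq → Fₚ.suc-injective (cong hi eq)) (Uniqueₚ.allFin⁺ n)

  star∈starCode : (t : Fin n) → star t ∈ starCode
  star∈starCode t = ∈-map⁺ star (∈-allFin t)

  ∈-starCode : (u : Pair (suc n)) → F.zero ∈ₚ u → u ∈ starCode
  ∈-starCode (_ , F.zero  , ()) _
  ∈-starCode (_ , F.suc t , _)  (inj₁ refl) = subst (_∈ starCode) (≡-Pair refl refl) (star∈starCode t)

  star-disjoint : {t : Fin n} (v : Pair (suc n)) → ¬ F.zero ∈ₚ v → ¬ F.suc t ∈ₚ v → ClosedNbhd (KneserAdj (suc n)) v (star t)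
  star-disjoint v 0∉v t∉v = inj₂ λ { s (s∈v , inj₁ refl) → 0∉v s∈v ; s (s∈v , inj₂ refl) → t∉v s∈v }

  star-avoiding : 5 ≤ n → (u v : Pair (suc n)) → Σ[ t ∈ Fin n ] (¬ F.suc t ∈ₚ u × ¬ F.suc t ∈ₚ v)
  star-avoiding 5≤n u v with avoid (F.zero ∷ lo u ∷ hi u ∷ lo v ∷ hi v ∷ []) (s≤s 5≤n)
  ... | F.zero  , w∉ = ⊥-elim (w∉ (here refl))
  ... | F.suc t , w∉ = t , [ w∉ ∘ there ∘ here , w∉ ∘ there ∘ there ∘ here ]′
                         , [ w∉ ∘ there ∘ there ∘ there ∘ here , w∉ ∘ there ∘ there ∘ there ∘ there ∘ here ]′

  starCode-identifying : 5 ≤ n → IsIdentifyingCode (KneserAdj (suc n)) starCode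
  starCode-identifying 5≤n = starCode-unique , dominated , separated
    where
    N = ClosedNbhd (KneserAdj (suc n))

    dominated : ∀ u → Σ[ c ∈ Pair (suc n) ] (c ∈ starCode × N u c)
    dominated u with F.zero ∈ₚ? u
    ... | yes 0∈u = u , ∈-starCode u 0∈u , inj₁ refl
    ... | no  0∉u = let t , t∉u , _ = star-avoiding 5≤n u u in star t , star∈starCode t , star-disjoint u 0∉u t∉u

    -- Some star edge avoids both u and v; it lies in N[v] but not in N[u].
    one-sided : ∀ u v → F.zero ∈ₚ u → ¬ F.zero ∈ₚ v → ¬ (∀ c → c ∈ starCode → N u c ⇔ N v c)
    one-sided u v 0∈u 0∉v same with star-avoiding 5≤n u v
    ... | t , t∉u , t∉v with Equivalence.from (same (star t) (star∈starCode t)) (star-disjoint v 0∉v t∉v)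
    ...   | inj₁ refl     = t∉u (inj₂ refl)
    ...   | inj₂ u∩star=∅ = u∩star=∅ F.zero (0∈u , inj₁ refl)

    separated : ∀ u v → u ≢ v → ¬ (∀ c → c ∈ starCode → N u c ⇔ N v c)
    separated u v u≢v same with F.zero ∈ₚ? u | F.zero ∈ₚ? v
    ... | yes 0∈u | yes 0∈v with Equivalence.to (same u (∈-starCode u 0∈u)) (inj₁ refl)
    ...   | inj₁ u≡v    = u≢v u≡v
    ...   | inj₂ v∩u=∅  = v∩u=∅ F.zero (0∈v , 0∈u)
    separated u v u≢v same | yes 0∈u | no 0∉v = one-sided u v 0∈u 0∉v same
    separated u v u≢v same | no 0∉u | yes 0∈v = one-sided v u 0∈v 0∉u (λ c c∈ → ⇔.sym (same c c∈))
    separated u v u≢v same | no 0∉u | no 0∉v with ∃∈ₚ-∖ u v u≢v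
    ... | F.zero  , 0∈u , _   = 0∉u 0∈u
    ... | F.suc t , t∈u , t∉v with Equivalence.from (same (star t) (star∈starCode t)) (star-disjoint v 0∉v t∉v)
    ...   | inj₁ refl     = 0∉u (inj₁ refl)
    ...   | inj₂ u∩star=∅ = u∩star=∅ (F.suc t) (t∈u , inj₂ refl)

module Cycle (n : ℕ) where

  private
    M = suc n

    [x+k]%M≢x : ∀ x k → x < M → 0 < k → k < M → (x + k) % M ≢ x
    [x+k]%M≢x x k x<M 0<k k<M eq with x + k ℕ.<? M
    ... | yes x+k<M = ℕₚ.<⇒≢ 0<k (sym (ℕₚ.+-cancelˡ-≡ x k 0 (begin
      x + k       ≡⟨ m<n⇒m%n≡m x+k<M ⟨
      (x + k) % M ≡⟨ eq ⟩
      x           ≡⟨ ℕₚ.+-identityʳ x ⟨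
      x + 0       ∎)))
      where open ≡-Reasoning
    ... | no  x+k≮M = ℕₚ.<⇒≢ k<M (ℕₚ.+-cancelˡ-≡ x k M (begin
      x + k       ≡⟨ d+M≡x+k ⟨
      d + M       ≡⟨ cong (_+ M) d≡x ⟩
      x + M       ∎))
      where
      open ≡-Reasoning
      d = x + k ∸ M
      d+M≡x+k : d + M ≡ x + k
      d+M≡x+k = ℕₚ.m∸n+n≡m (ℕₚ.≮⇒≥ x+k≮M)
      d<M : d < M
      d<M = ℕₚ.+-cancelʳ-< M d M (subst (_< M + M) (sym d+M≡x+k) (ℕₚ.+-mono-< x<M k<M))
      d≡x : d ≡ x
      d≡x = begin
        d           ≡⟨ m<n⇒m%n≡m d<M ⟨
        d % M       ≡⟨ [m+n]%n≡m%n d M ⟨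
        (d + M) % M ≡⟨ cong (_% M) d+M≡x+k ⟩
        (x + k) % M ≡⟨ eq ⟩
        x           ∎

  opaque
    shift : ℕ → Fin M → Fin M
    shift k x = F.fromℕ< (m%n<n (F.toℕ x + k) M)

    toℕ-shift : ∀ k x → F.toℕ (shift k x) ≡ (F.toℕ x + k) % M
    toℕ-shift k x = Fₚ.toℕ-fromℕ< _

  shift-shift : ∀ a b x → shift a (shift b x) ≡ shift (b + a) x
  shift-shift a b x = Fₚ.toℕ-injective (begin
    F.toℕ (shift a (shift b x))           ≡⟨ toℕ-shift a (shift b x) ⟩
    (F.toℕ (shift b x) + a) % M           ≡⟨ cong (λ t → (t + a) % M) (toℕ-shift b x) ⟩
    ((F.toℕ x + b) % M + a) % M           ≡⟨ %-distribˡ-+ ((F.toℕ x + b) % M) a M ⟩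
    ((F.toℕ x + b) % M % M + a % M) % M   ≡⟨ cong (λ t → (t + a % M) % M) (m%n%n≡m%n (F.toℕ x + b) M) ⟩
    ((F.toℕ x + b) % M + a % M) % M       ≡⟨ %-distribˡ-+ (F.toℕ x + b) a M ⟨
    (F.toℕ x + b + a) % M                 ≡⟨ cong (_% M) (ℕₚ.+-assoc (F.toℕ x) b a) ⟩
    (F.toℕ x + (b + a)) % M               ≡⟨ toℕ-shift (b + a) x ⟨
    F.toℕ (shift (b + a) x)               ∎)
    where open ≡-Reasoning

  shift-M : ∀ x → shift M x ≡ x
  shift-M x = Fₚ.toℕ-injective (trans (toℕ-shift M x) (trans ([m+n]%n≡m%n (F.toℕ x) M) (m<n⇒m%n≡m (Fₚ.toℕ<n x))))

  shift-0 : ∀ x → shift 0 x ≡ x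
  shift-0 x = Fₚ.toℕ-injective (trans (toℕ-shift 0 x) (trans (cong (_% M) (ℕₚ.+-identityʳ (F.toℕ x))) (m<n⇒m%n≡m (Fₚ.toℕ<n x))))

  shift-≢ : ∀ k x → 0 < k → k < M → shift k x ≢ x
  shift-≢ k x 0<k k<M eq = [x+k]%M≢x (F.toℕ x) k (Fₚ.toℕ<n x) 0<k k<M (trans (sym (toℕ-shift k x)) (cong F.toℕ eq))

  next prev : Fin M → Fin M
  next = shift 1
  prev = shift n

  next-prev : ∀ x → next (prev x) ≡ x
  next-prev x = trans (shift-shift 1 n x) (subst (λ k → shift k x ≡ x) (ℕₚ.+-comm 1 n) (shift-M x))

  prev-next : ∀ x → prev (next x) ≡ x
  prev-next x = trans (shift-shift n 1 x) (shift-M x)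

  next-injective : ∀ {x y} → next x ≡ next y → x ≡ y
  next-injective {x} {y} eq = trans (sym (prev-next x)) (trans (cong prev eq) (prev-next y))

  next^ : ℕ → Fin M → Fin M
  next^ zero    x = x
  next^ (suc k) x = next (next^ k x)

  next^≢ : ∀ k x → 0 < k → k < M → next^ k x ≢ x
  next^≢ k x 0<k k<M = shift-≢ k x 0<k k<M ∘ trans (sym (next^≡shift k))
    where
    next^≡shift : ∀ k → next^ k x ≡ shift k x
    next^≡shift zero    = sym (shift-0 x)
    next^≡shift (suc k) = trans (cong next (next^≡shift k)) (trans (shift-shift 1 k x) (cong (λ j → shift j x) (ℕₚ.+-comm k 1)))

module CycleCode (n : ℕ) (4≤n : 4 ≤ n) where

  open Cycle n

  private
    next^≢′ : ∀ k x → 0 < k → k ≤ 4 → next^ k x ≢ x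
    next^≢′ k x 0<k k≤4 = next^≢ k x 0<k (s≤s (ℕₚ.≤-trans k≤4 4≤n))

    x≢next : ∀ x → x ≢ next x
    x≢next x = ≢-sym (next^≢′ 1 x (s≤s z≤n) (s≤s z≤n))

    prev≢next : ∀ x → prev x ≢ next x
    prev≢next x eq = next^≢′ 2 x (s≤s z≤n) (s≤s (s≤s z≤n)) (sym (trans (sym (next-prev x)) (cong next eq)))

  edge : Fin (suc n) → Pair (suc n)
  edge x = pair x (next x) (x≢next x)

  edge-injective : ∀ {x y} → edge x ≡ edge y → x ≡ y
  edge-injective {x} {y} eq with ∈ₚ-pair⁻ y (next y) (x≢next y) (subst (x ∈ₚ_) eq (∈ₚ-pairˡ _ _ (x≢next x)))
  ... | inj₁ x≡y = x≡y
  ... | inj₂ refl with ∈ₚ-pair⁻ y (next y) (x≢next y) (subst (next x ∈ₚ_) eq (∈ₚ-pairʳ _ _ (x≢next x)))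
  ...   | inj₁ next²y≡y     = ⊥-elim (next^≢′ 2 y (s≤s z≤n) (s≤s (s≤s z≤n)) next²y≡y)
  ...   | inj₂ next²y≡nexty = next-injective next²y≡nexty

  -- Opaque so that with-abstraction does not unfold the code into the goal.
  opaque
    cycleCode : List (Pair (suc n))
    cycleCode = map edge (allFin (suc n))

    length-cycleCode : length cycleCode ≡ suc n
    length-cycleCode = trans (length-map edge (allFin (suc n))) (length-tabulate id)

    edge∈cycleCode : ∀ x → edge x ∈ cycleCode
    edge∈cycleCode x = ∈-map⁺ edge (∈-allFin x)

    cycleCode-unique : Unique cycleCode
    cycleCode-unique = Uniqueₚ.map⁺ edge-injective (Uniqueₚ.allFin⁺ (suc n))

  missing⇒neighbours : ∀ u v {x} → Covers cycleCode u v → x ∈ₚ u → ¬ x ∈ₚ v → next x ∈ₚ v × prev x ∈ₚ v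
  missing⇒neighbours u v {x} u⊑v x∈u x∉v = next∈v , prev∈v
    where
    x∈edge[prev] : x ∈ₚ edge (prev x)
    x∈edge[prev] = subst (_∈ₚ edge (prev x)) (next-prev x) (∈ₚ-pairʳ _ _ (x≢next (prev x)))
    next∈v : next x ∈ₚ v
    next∈v with u⊑v (edge x) (edge∈cycleCode x) (x , x∈u , ∈ₚ-pairˡ _ _ (x≢next x))
    ... | t , t∈v , t∈edge with ∈ₚ-pair⁻ _ _ (x≢next x) t∈edge
    ...   | inj₁ refl = ⊥-elim (x∉v t∈v)
    ...   | inj₂ refl = t∈v
    prev∈v : prev x ∈ₚ v
    prev∈v with u⊑v (edge (prev x)) (edge∈cycleCode (prev x)) (x , x∈u , x∈edge[prev])
    ... | t , t∈v , t∈edge with ∈ₚ-pair⁻ _ _ (x≢next (prev x)) t∈edge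
    ...   | inj₁ refl    = t∈v
    ...   | inj₂ t≡x     = ⊥-elim (x∉v (subst (_∈ₚ v) (trans t≡x (next-prev x)) t∈v))

  -- With x ∈ u ∖ v and next x ∈ v ∖ u, both pairs are forced: v = {x-1, x+1} and u = {x, x+2};
  -- then x+2 can lie neither in v nor outside it.
  ¬adjacent-differences : ∀ u v {x} → Covers cycleCode u v → Covers cycleCode v u →
                          x ∈ₚ u → ¬ x ∈ₚ v → next x ∈ₚ v → ¬ next x ∈ₚ u → ⊥
  ¬adjacent-differences u v {x} u⊑v v⊑u x∈u x∉v next∈v next∉u
    with missing⇒neighbours u v u⊑v x∈u x∉v | missing⇒neighbours v u v⊑u next∈v next∉u
  ... | _ , prev∈v | next²∈u , _ with next (next x) ∈ₚ? v
  ...   | yes next²∈v with ∈ₚ-only v (prev≢next x) prev∈v next∈v next²∈v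
  ...     | inj₁ next²≡prev = next^≢′ 3 x (s≤s z≤n) (s≤s (s≤s (s≤s z≤n))) (trans (cong next next²≡prev) (next-prev x))
  ...     | inj₂ next²≡next = next^≢′ 1 x (s≤s z≤n) (s≤s z≤n) (next-injective next²≡next)
  ¬adjacent-differences u v {x} u⊑v v⊑u x∈u x∉v next∈v next∉u
      | _ , prev∈v | next²∈u , _ | no next²∉v with ∈ₚ-only v (prev≢next x) prev∈v next∈v (proj₁ (missing⇒neighbours u v u⊑v next²∈u next²∉v))
  ...     | inj₁ next³≡prev = next^≢′ 4 x (s≤s z≤n) ℕₚ.≤-refl (trans (cong next next³≡prev) (next-prev x))
  ...     | inj₂ next³≡next = next^≢′ 2 x (s≤s z≤n) (s≤s (s≤s z≤n)) (next-injective next³≡next)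

  cycleCode-separates : ∀ u v → u ≢ v → Covers cycleCode u v → Covers cycleCode v u → ⊥
  cycleCode-separates u v u≢v u⊑v v⊑u with ∃∈ₚ-∖ u v u≢v
  ... | x , x∈u , x∉v with missing⇒neighbours u v u⊑v x∈u x∉v | ∃∈ₚ-∖ v u (≢-sym u≢v)
  ...   | next∈v , prev∈v | y , y∈v , y∉u with ∈ₚ-only v (prev≢next x) prev∈v next∈v y∈v
  ...     | inj₂ refl = ¬adjacent-differences u v u⊑v v⊑u x∈u x∉v y∈v y∉u
  ...     | inj₁ refl = ¬adjacent-differences v u v⊑u u⊑v y∈v y∉u (subst (_∈ₚ u) (sym (next-prev x)) x∈u)
                                                            (subst (λ t → ¬ t ∈ₚ v) (sym (next-prev x)) x∉v)

  cycleCode-identifying : IsIdentifyingCode (JohnsonAdj (suc n)) cycleCode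
  cycleCode-identifying = cycleCode-unique , dominated , separated
    where
    dominated : ∀ u → Σ[ c ∈ Pair (suc n) ] (c ∈ cycleCode × ClosedNbhd (JohnsonAdj (suc n)) u c)
    dominated u = edge (lo u) , edge∈cycleCode (lo u) ,
                  Equivalence.from johnsonN⇔Meets (lo u , lo∈ₚ u , ∈ₚ-pairˡ _ _ (x≢next (lo u)))
    separated : ∀ u v → u ≢ v → ¬ (∀ c → c ∈ cycleCode → ClosedNbhd (JohnsonAdj (suc n)) u c ⇔ ClosedNbhd (JohnsonAdj (suc n)) v c)
    separated u v u≢v same = cycleCode-separates u v u≢v
      (λ c c∈ → Equivalence.to johnsonN⇔Meets ∘ Equivalence.to (same c c∈) ∘ Equivalence.from johnsonN⇔Meets)
      (λ c c∈ → Equivalence.to johnsonN⇔Meets ∘ Equivalence.from (same c c∈) ∘ Equivalence.from johnsonN⇔Meets)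

idCodeNumber-bounds : {Adj : Pair m → Pair m → Set} → (∀ u v → Dec (Adj u v)) →
                      (C₀ : List (Pair m)) → IsIdentifyingCode Adj C₀ → length C₀ ≤ m →
                      (∀ C → IsIdentifyingCode Adj C → 2 * m ≤ 3 * length C) →
                      Σ[ k ∈ ℕ ] (IsIDCodeNumber Adj k × (2 * m ≤ 3 * k × 3 * k ≤ 4 * (m + 1)))
idCodeNumber-bounds {m} adj? C₀ C₀-id C₀≤m lower-bound with idCodeNumber-≤ _≟ₚ_ ∈-allPairs adj? C₀ C₀-id
... | k , ((C , C-id , refl) , minimal) , k≤C₀ =
  k , ((C , C-id , refl) , minimal) , lower-bound C C-id ,
  ℕₚ.*-mono-≤ (ℕₚ.n≤1+n 3) (ℕₚ.≤-trans k≤C₀ (ℕₚ.≤-trans C₀≤m (ℕₚ.m≤m+n m 1)))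

corollary4p7 : (m : ℕ) → 6 ≤ m →
    (Adj : Pair m → Pair m → Set) → (Adj ≡ KneserAdj m ⊎ Adj ≡ JohnsonAdj m) →
    Σ[ k ∈ ℕ ] (IsIDCodeNumber Adj k × (2 * m ≤ 3 * k × 3 * k ≤ 4 * (m + 1)))
corollary4p7 (suc n) 6≤m@(s≤s 5≤n) _ (inj₁ refl) =
  idCodeNumber-bounds kneser? starCode (starCode-identifying 5≤n)
                      (ℕₚ.≤-trans (ℕₚ.≤-reflexive length-starCode) (ℕₚ.n≤1+n n)) (kneser-lower-bound 6≤m)
  where open Star n
corollary4p7 (suc n) 6≤m@(s≤s 5≤n) _ (inj₂ refl) =
  idCodeNumber-bounds johnson? cycleCode cycleCode-identifying
                      (ℕₚ.≤-reflexive length-cycleCode) (johnson-lower-bound (ℕₚ.≤-trans (ℕₚ.m≤m+n 3 3) 6≤m))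
  where open CycleCode n (ℕₚ.≤-trans (ℕₚ.n≤1+n 4) 5≤n)
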